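{- Let $n>2$, $S_n=\{1,\dots,n\}$, and let $m_1',m_2'$ be subsets of $S_n$ with $m_1'\cup m_2'=S_n$, $\emptyset\subsetneq m_1',m_2'\subsetneq S_n$, $m_1'\cap m_2'\neq\emptyset$, and $m_1'\not\subseteq m_2'$, $m_2'\not\subseteq m_1'$. Let $\mathbb{K}_{12}=(S_n\cup\{g_1\},S_n\cup\{m_1,m_2\},I)$, with new elements $g_1,m_1,m_2$, where $gIm$ holds iff either $g,m\in S_n$ and $g\ne m$; or $g=g_1$ and $m\in S_n$; or $m=m_1$ and $g\in m_1'$; or $m=m_2$ and $g\in m_2'$. Let $\mathbb{K}_s=(S_n\cup\{g_1\},S_n\cup\{m_{12}\},J)$ be obtained by putting $m_1,m_2$ together: $J$ agrees with $I$ on attributes in $S_n$ and $g\,J\,m_{12}$ iff $g\in m_1'\cup m_2'$. Then: 1. $|\mathfrak{B}(\mathbb{K}_{12})|=2^n+2^{|m_2'|}+2^{|m_1'|}-2^{|m_1'\cap m_2'|}$; 2. $|\mathfrak{B}(\mathbb{K}_s)|-|\mathfrak{B}(\mathbb{K}_{12})|=2^n-2^{|m_1'|}-2^{|m_2'|}+2^{|m_1'\cap m_2'|}$.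
   Context: A formal context $(G,M,I)$ has objects $G$, attributes $M$, incidence $I\subseteq G\times M$. A formal concept is a pair $(A,B)$, $A\subseteq G$, $B\subseteq M$, such that $B$ is exactly the set of attributes shared by all objects of $A$ and $A$ is exactly the set of objects having all attributes of $B$. $\mathfrak{B}(\mathbb{K})$ is the set of concepts of $\mathbb{K}$. -}

module Defs where

open import Data.Nat using (ℕ; zero; suc)
open import Data.Bool using (Bool; true; false; _∧_; _∨_; not)
open import Data.Fin using (Fin; zero; suc; _≟_)
open import Data.Fin.Subset using (Subset)
open import Data.Vec using (lookup; tabulate)
open import Data.Product using (Σ; _×_; _,_)
open import Relation.Binary.PropositionalEquality using (_≡_)
open import Relation.Nullary.Decidable using (⌊_⌋)

record Context : Set where
  field
    nG : ℕ
    nM : ℕ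
    I  : Fin nG → Fin nM → Bool
open Context public

allFin : ∀ {k} → (Fin k → Bool) → Bool
allFin {zero}  f = true
allFin {suc k} f = f zero ∧ allFin (λ i → f (suc i))

_↑ : (K : Context) → Subset (nG K) → Subset (nM K)
(K ↑) A = tabulate λ m → allFin λ g → not (lookup A g) ∨ I K g m

_↓ : (K : Context) → Subset (nM K) → Subset (nG K)
(K ↓) B = tabulate λ g → allFin λ m → not (lookup B m) ∨ I K g m

Concept : Context → Set
Concept K = Σ (Subset (nG K) × Subset (nM K)) λ { (A , B) → (K ↑) A ≡ B × (K ↓) B ≡ A }

-- Contexts of Proposition 6.  S_n = Fin n.
-- Objects of both contexts: Fin (suc n); zero = g₁, suc i = i ∈ S_n.
-- Attributes of 𝕂₁₂: Fin (suc (suc n)); zero = m₁, suc zero = m₂,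
--   suc (suc j) = j ∈ S_n.
-- Attributes of 𝕂ₛ : Fin (suc n); zero = m₁₂, suc j = j ∈ S_n.
I₁₂ : ∀ {n} → Subset n → Subset n → Fin (suc n) → Fin (suc (suc n)) → Bool
I₁₂ m₁' m₂' zero    zero             = false
I₁₂ m₁' m₂' zero    (suc zero)       = false
I₁₂ m₁' m₂' zero    (suc (suc j))    = true
I₁₂ m₁' m₂' (suc i) zero             = lookup m₁' i
I₁₂ m₁' m₂' (suc i) (suc zero)       = lookup m₂' i
I₁₂ m₁' m₂' (suc i) (suc (suc j))    = not ⌊ i ≟ j ⌋

K₁₂ : ∀ {n} → Subset n → Subset n → Context
K₁₂ {n} m₁' m₂' = record { nG = suc n ; nM = suc (suc n) ; I = I₁₂ m₁' m₂' }

-- J: agrees with I on S_n, and g J m₁₂ iff g ∈ m₁' ∪ m₂'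
-- (g₁ is in neither m₁' nor m₂', which are subsets of S_n)
Iₛ : ∀ {n} → Subset n → Subset n → Fin (suc n) → Fin (suc n) → Bool
Iₛ m₁' m₂' zero    zero    = false
Iₛ m₁' m₂' zero    (suc j) = true
Iₛ m₁' m₂' (suc i) zero    = lookup m₁' i ∨ lookup m₂' i
Iₛ m₁' m₂' (suc i) (suc j) = not ⌊ i ≟ j ⌋

Kₛ : ∀ {n} → Subset n → Subset n → Context
Kₛ {n} m₁' m₂' = record { nG = suc n ; nM = suc n ; I = Iₛ m₁' m₂' }

module Submission where

-- A concept is determined by its extent, so 𝔅(K) is in
-- bijection with the closed object sets A = A''.  We therefore count
-- closed extents of both contexts as subsets of G = {g₁} ∪ S_n, written
-- x ∷ A with x recording whether g₁ belongs and A ⊆ S_n.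
-- On S_n × S_n both incidences are the contranominal scale (g I m iff
-- g ≠ m), so the S_n-part of A' is the complement of A and the closure
-- never changes A; only membership of g₁ can change.
--  * In 𝕂ₛ every object of S_n has m₁₂ (as m₁' ∪ m₂' = S_n), so g₁ is
--    never added: all 2^(n+1) sets are closed.
--  * In 𝕂₁₂ the closure adds g₁ to A exactly when A ⊄ m₁' and A ⊄ m₂', so
--    the closed extents are the 2^n sets containing g₁ plus the sets
--    A ⊆ m₁' or A ⊆ m₂', of which there are 2^|m₁'| + 2^|m₂'| − 2^|m₁'∩m₂'|
--    by inclusion–exclusion.

open import Defs
open import Data.Nat using (ℕ; _<_; _+_; _∸_; _^_)
open import Data.Integer as ℤ using (ℤ; +_)
open import Data.Fin using (Fin)
open import Data.Fin.Subset using (Subset; _∪_; _∩_; _⊂_; _⊆_; ⊤; ⊥; ∣_∣; Nonempty)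
open import Data.Product using (Σ; _×_)
open import Function.Bundles using (_↔_)
open import Relation.Binary.PropositionalEquality using (_≡_)
open import Relation.Nullary using (¬_)

open import Data.Nat using (zero; suc)
open import Data.Nat.Properties using (+-identityʳ; m+n∸n≡m)
open import Data.Integer.Properties using (pos-+)
import Data.Nat.Tactic.RingSolver as ℕ-Solver
import Data.Integer.Tactic.RingSolver as ℤ-Solver
open import Data.Bool using (Bool; true; false; _∧_; _∨_; not)
open import Data.Bool.Properties
  using (∨-zeroʳ; ∨-identityʳ; ∧-zeroʳ; ∧-identityʳ; not-involutive) renaming (_≟_ to _≟ᵇ_)
open import Data.Fin using (zero; suc; _≟_)
open import Data.Fin.Properties using (+↔⊎)
open import Data.Fin.Subset using (∁)
open import Data.Vec using (Vec; []; _∷_; lookup; tabulate)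
open import Data.Vec.Properties
  using (≡-dec; tabulate-cong; tabulate∘lookup; lookup-map; lookup-zipWith; lookup-replicate)
open import Data.Product using (_,_)
open import Data.Sum using (_⊎_; inj₁; inj₂)
open import Data.Sum.Function.Propositional using (_⊎-↔_)
open import Function.Bundles using (mk↔ₛ′)
open import Function.Construct.Composition using (_↔-∘_)
open import Relation.Binary.PropositionalEquality using (refl; sym; trans; cong; cong₂; subst; module ≡-Reasoning)
open import Relation.Nullary using (Dec; yes; no; contradiction)
open import Relation.Nullary.Decidable using (⌊_⌋; isYes≗does; dec-true; dec-false)
open import Axiom.UniquenessOfIdentityProofs using (UIP; module Decidable⇒UIP)

open ≡-Reasoning

uip-Bool : UIP Bool
uip-Bool = Decidable⇒UIP.≡-irrelevant _≟ᵇ_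

_≟ₛ_ : ∀ {k} (A B : Subset k) → Dec (A ≡ B)
_≟ₛ_ = ≡-dec _≟ᵇ_

uip-Subset : ∀ {k} → UIP (Subset k)
uip-Subset = Decidable⇒UIP.≡-irrelevant _≟ₛ_

⌊⌋-true : ∀ {P : Set} (d : Dec P) → P → ⌊ d ⌋ ≡ true
⌊⌋-true d p = trans (isYes≗does d) (dec-true d p)

⌊⌋-false : ∀ {P : Set} (d : Dec P) → ¬ P → ⌊ d ⌋ ≡ false
⌊⌋-false d ¬p = trans (isYes≗does d) (dec-false d ¬p)

tabulate-≡ : ∀ {k} {X : Set} (f : Fin k → X) (v : Vec X k) →
  (∀ i → f i ≡ lookup v i) → tabulate f ≡ v
tabulate-≡ f v f≗v = trans (tabulate-cong f≗v) (tabulate∘lookup v)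

allFin-true : ∀ {k} (f : Fin k → Bool) → (∀ i → f i ≡ true) → allFin f ≡ true
allFin-true {zero}  f f≡true = refl
allFin-true {suc k} f f≡true rewrite f≡true zero = allFin-true (λ i → f (suc i)) (λ i → f≡true (suc i))

allFin-cong : ∀ {k} (f g : Fin k → Bool) → (∀ i → f i ≡ g i) → allFin f ≡ allFin g
allFin-cong {zero}  f g f≗g = refl
allFin-cong {suc k} f g f≗g = cong₂ _∧_ (f≗g zero) (allFin-cong _ _ (λ i → f≗g (suc i)))

suc-≟ : ∀ {k} (i j : Fin k) → ⌊ suc i ≟ suc j ⌋ ≡ ⌊ i ≟ j ⌋
suc-≟ i j with i ≟ j
... | yes _ = refl
... | no  _ = refl

≟-sym : ∀ {k} (i j : Fin k) → ⌊ i ≟ j ⌋ ≡ ⌊ j ≟ i ⌋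
≟-sym i j with i ≟ j | j ≟ i
... | yes _   | yes _   = refl
... | no  _   | no  _   = refl
... | yes i≡j | no  j≢i = contradiction (sym i≡j) j≢i
... | no  i≢j | yes j≡i = contradiction (sym j≡i) i≢j

contranominal : ∀ {k} (A : Subset k) (j : Fin k) →
  allFin (λ i → not (lookup A i) ∨ not ⌊ i ≟ j ⌋) ≡ not (lookup A j)
contranominal (true  ∷ A) zero = refl
contranominal (false ∷ A) zero = allFin-true _ (λ i → ∨-zeroʳ (not (lookup A i)))
contranominal (a ∷ A) (suc j) = begin
    (not a ∨ true) ∧ allFin (λ i → not (lookup A i) ∨ not ⌊ suc i ≟ suc j ⌋)
  ≡⟨ cong₂ _∧_ (∨-zeroʳ (not a))
       (allFin-cong _ _ (λ i → cong (λ b → not (lookup A i) ∨ not b) (suc-≟ i j))) ⟩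
    allFin (λ i → not (lookup A i) ∨ not ⌊ i ≟ j ⌋)
  ≡⟨ contranominal A j ⟩
    not (lookup A j) ∎

contranominal-↑ : ∀ {k} (A : Subset k) (j : Fin k) →
  allFin (λ i → not (lookup A i) ∨ not ⌊ i ≟ j ⌋) ≡ lookup (∁ A) j
contranominal-↑ A j = trans (contranominal A j) (sym (lookup-map j not A))

contranominal-↓ : ∀ {k} (A : Subset k) (i : Fin k) →
  allFin (λ j → not (lookup (∁ A) j) ∨ not ⌊ i ≟ j ⌋) ≡ lookup A i
contranominal-↓ A i = begin
    allFin (λ j → not (lookup (∁ A) j) ∨ not ⌊ i ≟ j ⌋)
  ≡⟨ allFin-cong _ _ (λ j → cong (λ b → not (lookup (∁ A) j) ∨ not b) (≟-sym i j)) ⟩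
    allFin (λ j → not (lookup (∁ A) j) ∨ not ⌊ j ≟ i ⌋)
  ≡⟨ contranominal (∁ A) i ⟩
    not (lookup (∁ A) i)
  ≡⟨ cong not (lookup-map i not A) ⟩
    not (not (lookup A i))
  ≡⟨ not-involutive (lookup A i) ⟩
    lookup A i ∎

-- The same, as it appears in the derivation of an object set x ∷ A
-- whose extra object g₁ has every attribute of the scale.
contranominal-↑′ : ∀ {k} (x : Bool) (A : Subset k) (j : Fin k) →
  ((not x ∨ true) ∧ allFin (λ i → not (lookup A i) ∨ not ⌊ i ≟ j ⌋)) ≡ lookup (∁ A) j
contranominal-↑′ x A j = trans (cong (_∧ _) (∨-zeroʳ (not x))) (contranominal-↑ A j)

-- Boolean inclusion test, in the form produced by the derivation operators.
_⊆ᵇ_ : ∀ {k} → Subset k → Subset k → Bool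
A ⊆ᵇ m = allFin (λ i → not (lookup A i) ∨ lookup m i)

⊆ᵇ-sound : ∀ {k} (A m : Subset k) (i : Fin k) →
  A ⊆ᵇ m ≡ true → lookup A i ≡ true → lookup m i ≡ true
⊆ᵇ-sound (true  ∷ A) (false ∷ m) i       ()  _
⊆ᵇ-sound (true  ∷ A) (true  ∷ m) zero    _   _   = refl
⊆ᵇ-sound (true  ∷ A) (true  ∷ m) (suc i) A⊆m i∈A = ⊆ᵇ-sound A m i A⊆m i∈A
⊆ᵇ-sound (false ∷ A) m           zero    _   ()
⊆ᵇ-sound (false ∷ A) (b ∷ m)     (suc i) A⊆m i∈A = ⊆ᵇ-sound A m i A⊆m i∈A

⊆ᵇ-∩ : ∀ {k} (A m₁ m₂ : Subset k) → (A ⊆ᵇ m₁ ∧ A ⊆ᵇ m₂) ≡ A ⊆ᵇ (m₁ ∩ m₂)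
⊆ᵇ-∩ []      []       []       = refl
⊆ᵇ-∩ (a ∷ A) (b₁ ∷ m₁) (b₂ ∷ m₂) =
  trans (interleave a b₁ b₂ (A ⊆ᵇ m₁) (A ⊆ᵇ m₂)) (cong ((not a ∨ (b₁ ∧ b₂)) ∧_) (⊆ᵇ-∩ A m₁ m₂))
  where
  interleave : ∀ a b₁ b₂ s₁ s₂ →
    (((not a ∨ b₁) ∧ s₁) ∧ ((not a ∨ b₂) ∧ s₂)) ≡ ((not a ∨ (b₁ ∧ b₂)) ∧ (s₁ ∧ s₂))
  interleave false b₁    b₂    s₁ s₂ = refl
  interleave true  true  true  s₁ s₂ = refl
  interleave true  true  false s₁ s₂ = ∧-zeroʳ s₁
  interleave true  false b₂    s₁ s₂ = refl

indicator : Bool → ℕ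
indicator true  = 1
indicator false = 0

count : ∀ {k} → (Subset k → Bool) → ℕ
count {zero}  f = indicator (f [])
count {suc k} f = count (λ A → f (false ∷ A)) + count (λ A → f (true ∷ A))

Satisfying : ∀ {k} → (Subset k → Bool) → Set
Satisfying {k} f = Σ (Subset k) (λ A → f A ≡ true)

indicator-↔ : ∀ b → Fin (indicator b) ↔ (b ≡ true)
indicator-↔ true  = mk↔ₛ′ (λ _ → refl) (λ _ → zero) (uip-Bool refl) (λ { zero → refl })
indicator-↔ false = mk↔ₛ′ (λ ()) (λ ()) (λ ()) (λ ())

subsets-0 : (f : Subset 0 → Bool) → (f [] ≡ true) ↔ Satisfying f
subsets-0 f = mk↔ₛ′ ([] ,_) (λ { ([] , p) → p }) (λ { ([] , p) → refl }) (λ _ → refl)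

subsets-suc : ∀ {k} (f : Subset (suc k) → Bool) →
  (Satisfying (λ A → f (false ∷ A)) ⊎ Satisfying (λ A → f (true ∷ A))) ↔ Satisfying f
subsets-suc f = mk↔ₛ′ to from to∘from from∘to
  where
  to : Satisfying (λ A → f (false ∷ A)) ⊎ Satisfying (λ A → f (true ∷ A)) → Satisfying f
  to (inj₁ (A , p)) = false ∷ A , p
  to (inj₂ (A , p)) = true ∷ A , p
  from : Satisfying f → Satisfying (λ A → f (false ∷ A)) ⊎ Satisfying (λ A → f (true ∷ A))
  from (false ∷ A , p) = inj₁ (A , p)
  from (true  ∷ A , p) = inj₂ (A , p)
  to∘from : ∀ y → to (from y) ≡ y
  to∘from (false ∷ A , p) = refl
  to∘from (true  ∷ A , p) = refl
  from∘to : ∀ x → from (to x) ≡ x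
  from∘to (inj₁ _) = refl
  from∘to (inj₂ _) = refl

count-↔ : ∀ {k} (f : Subset k → Bool) → Fin (count f) ↔ Satisfying f
count-↔ {zero}  f = subsets-0 f ↔-∘ indicator-↔ (f [])
count-↔ {suc k} f =
  subsets-suc f ↔-∘ ((count-↔ (λ A → f (false ∷ A)) ⊎-↔ count-↔ (λ A → f (true ∷ A))) ↔-∘ +↔⊎)

count-cong : ∀ {k} (f g : Subset k → Bool) → (∀ A → f A ≡ g A) → count f ≡ count g
count-cong {zero}  f g f≗g = cong indicator (f≗g [])
count-cong {suc k} f g f≗g =
  cong₂ _+_ (count-cong _ _ (λ A → f≗g (false ∷ A))) (count-cong _ _ (λ A → f≗g (true ∷ A)))

count-false : ∀ {k} → count {k} (λ _ → false) ≡ 0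
count-false {zero}  = refl
count-false {suc k} = cong₂ _+_ (count-false {k}) (count-false {k})

count-true : ∀ {k} → count {k} (λ _ → true) ≡ 2 ^ k
count-true {zero}  = refl
count-true {suc k} = cong₂ _+_ (count-true {k}) (trans (count-true {k}) (sym (+-identityʳ (2 ^ k))))

count-⊆ᵇ : ∀ {k} (m : Subset k) → count (λ A → A ⊆ᵇ m) ≡ 2 ^ ∣ m ∣
count-⊆ᵇ []          = refl
count-⊆ᵇ (true ∷ m)  = cong₂ _+_ (count-⊆ᵇ m) (trans (count-⊆ᵇ m) (sym (+-identityʳ (2 ^ ∣ m ∣))))
count-⊆ᵇ {suc k} (false ∷ m) = trans (cong₂ _+_ (count-⊆ᵇ m) (count-false {k})) (+-identityʳ (2 ^ ∣ m ∣))

count-inclusion-exclusion : ∀ {k} (f g : Subset k → Bool) →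
  count f + count g ≡ count (λ A → f A ∨ g A) + count (λ A → f A ∧ g A)
count-inclusion-exclusion {zero} f g = for-one-set (f []) (g [])
  where
  for-one-set : ∀ a b → indicator a + indicator b ≡ indicator (a ∨ b) + indicator (a ∧ b)
  for-one-set true  b     = refl
  for-one-set false true  = refl
  for-one-set false false = refl
count-inclusion-exclusion {suc k} f g = begin
    (#f₀ + #f₁) + (#g₀ + #g₁)
  ≡⟨ interchange #f₀ #f₁ #g₀ #g₁ ⟩
    (#f₀ + #g₀) + (#f₁ + #g₁)
  ≡⟨ cong₂ _+_ (count-inclusion-exclusion f₀ g₀) (count-inclusion-exclusion f₁ g₁) ⟩
    (count (λ A → f₀ A ∨ g₀ A) + count (λ A → f₀ A ∧ g₀ A)) +
    (count (λ A → f₁ A ∨ g₁ A) + count (λ A → f₁ A ∧ g₁ A))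
  ≡⟨ interchange (count (λ A → f₀ A ∨ g₀ A)) _ _ _ ⟩
    count (λ A → f A ∨ g A) + count (λ A → f A ∧ g A) ∎
  where
  f₀ f₁ g₀ g₁ : Subset k → Bool
  f₀ A = f (false ∷ A)
  f₁ A = f (true ∷ A)
  g₀ A = g (false ∷ A)
  g₁ A = g (true ∷ A)
  #f₀ #f₁ #g₀ #g₁ : ℕ
  #f₀ = count f₀
  #f₁ = count f₁
  #g₀ = count g₀
  #g₁ = count g₁
  interchange : ∀ a b c d → (a + b) + (c + d) ≡ (a + c) + (b + d)
  interchange = ℕ-Solver.solve-∀

count-⊆-either : ∀ {k} (m₁ m₂ : Subset k) →
  2 ^ ∣ m₁ ∣ + 2 ^ ∣ m₂ ∣ ≡ count (λ A → A ⊆ᵇ m₁ ∨ A ⊆ᵇ m₂) + 2 ^ ∣ m₁ ∩ m₂ ∣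
count-⊆-either m₁ m₂ = begin
    2 ^ ∣ m₁ ∣ + 2 ^ ∣ m₂ ∣
  ≡⟨ sym (cong₂ _+_ (count-⊆ᵇ m₁) (count-⊆ᵇ m₂)) ⟩
    count (λ A → A ⊆ᵇ m₁) + count (λ A → A ⊆ᵇ m₂)
  ≡⟨ count-inclusion-exclusion (λ A → A ⊆ᵇ m₁) (λ A → A ⊆ᵇ m₂) ⟩
    count (λ A → A ⊆ᵇ m₁ ∨ A ⊆ᵇ m₂) + count (λ A → A ⊆ᵇ m₁ ∧ A ⊆ᵇ m₂)
  ≡⟨ cong (_+_ (count (λ A → A ⊆ᵇ m₁ ∨ A ⊆ᵇ m₂)))
       (trans (count-cong _ _ (λ A → ⊆ᵇ-∩ A m₁ m₂)) (count-⊆ᵇ (m₁ ∩ m₂))) ⟩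
    count (λ A → A ⊆ᵇ m₁ ∨ A ⊆ᵇ m₂) + 2 ^ ∣ m₁ ∩ m₂ ∣ ∎

isExtent : (K : Context) → Subset (nG K) → Bool
isExtent K A = ⌊ (K ↓) ((K ↑) A) ≟ₛ A ⌋

extents↔concepts : (K : Context) → Satisfying (isExtent K) ↔ Concept K
extents↔concepts K = mk↔ₛ′ to from to∘from from∘to
  where
  closed : ∀ {A} → isExtent K A ≡ true → (K ↓) ((K ↑) A) ≡ A
  closed {A} isClosed with (K ↓) ((K ↑) A) ≟ₛ A
  closed {A} isClosed | yes A''≡A = A''≡A
  closed {A} ()       | no  _
  to : Satisfying (isExtent K) → Concept K
  to (A , isClosed) = (A , (K ↑) A) , refl , closed isClosed
  from : Concept K → Satisfying (isExtent K)
  from ((A , B) , A'≡B , B'≡A) = A , ⌊⌋-true (_ ≟ₛ A) (trans (cong (K ↓) A'≡B) B'≡A)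
  to∘from : ∀ c → to (from c) ≡ c
  to∘from ((A , B) , refl , B'≡A) = cong (λ p → (A , B) , refl , p) (uip-Subset _ _)
  from∘to : ∀ e → from (to e) ≡ e
  from∘to (A , isClosed) = cong (A ,_) (uip-Bool _ _)

concepts-count : (K : Context) → Fin (count (isExtent K)) ↔ Concept K
concepts-count K = extents↔concepts K ↔-∘ count-↔ (isExtent K)

≟ₛ-same-tail : ∀ {k} (h x : Bool) (A : Subset k) → ⌊ (h ∷ A) ≟ₛ (x ∷ A) ⌋ ≡ ⌊ h ≟ᵇ x ⌋
≟ₛ-same-tail true  true  A = ⌊⌋-true  ((true ∷ A) ≟ₛ (true ∷ A)) refl
≟ₛ-same-tail false false A = ⌊⌋-true  ((false ∷ A) ≟ₛ (false ∷ A)) refl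
≟ₛ-same-tail true  false A = ⌊⌋-false ((true ∷ A) ≟ₛ (false ∷ A)) (λ ())
≟ₛ-same-tail false true  A = ⌊⌋-false ((false ∷ A) ≟ₛ (true ∷ A)) (λ ())

⇒-absorb : ∀ b c a → (b ≡ true → a ≡ true → c ≡ true) → ((not b ∨ c) ∧ a) ≡ a
⇒-absorb false c     a     _     = refl
⇒-absorb true  c     false _     = ∧-zeroʳ c
⇒-absorb true  c     true  b∧a⇒c = trans (∧-identityʳ c) (b∧a⇒c refl refl)

head-entry : ∀ c t → t ≡ true → ((c ∨ false) ∧ t) ≡ c
head-entry c t refl = trans (∧-identityʳ (c ∨ false)) (∨-identityʳ c)

-- g₁ has every attribute of S_n, so those attributes never exclude g₁ from
-- an extent.
all-∨-true : ∀ {k} (B : Subset k) → allFin (λ j → not (lookup B j) ∨ true) ≡ true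
all-∨-true B = allFin-true _ (λ j → ∨-zeroʳ (not (lookup B j)))

↑-K₁₂ : ∀ {n} (m₁ m₂ : Subset n) (x : Bool) (A : Subset n) →
  (K₁₂ m₁ m₂ ↑) (x ∷ A) ≡ (not x ∧ A ⊆ᵇ m₁) ∷ (not x ∧ A ⊆ᵇ m₂) ∷ ∁ A
↑-K₁₂ m₁ m₂ x A =
  cong₂ _∷_ (cong (_∧ A ⊆ᵇ m₁) (∨-identityʳ (not x)))
    (cong₂ _∷_ (cong (_∧ A ⊆ᵇ m₂) (∨-identityʳ (not x)))
      (tabulate-≡ _ (∁ A) (contranominal-↑′ x A)))

↓-K₁₂ : ∀ {n} (m₁ m₂ : Subset n) (b₁ b₂ : Bool) (A : Subset n) →
  (K₁₂ m₁ m₂ ↓) (b₁ ∷ b₂ ∷ ∁ A) ≡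
  (not b₁ ∧ not b₂) ∷ tabulate (λ i → (not b₁ ∨ lookup m₁ i) ∧ ((not b₂ ∨ lookup m₂ i) ∧ lookup A i))
↓-K₁₂ m₁ m₂ b₁ b₂ A =
  cong₂ _∷_ (cong₂ _∧_ (∨-identityʳ (not b₁)) (head-entry (not b₂) _ (all-∨-true (∁ A))))
    (tabulate-cong (λ i →
      cong (λ z → (not b₁ ∨ lookup m₁ i) ∧ ((not b₂ ∨ lookup m₂ i) ∧ z)) (contranominal-↓ A i)))

closure-K₁₂ : ∀ {n} (m₁ m₂ : Subset n) (x : Bool) (A : Subset n) →
  (K₁₂ m₁ m₂ ↓) ((K₁₂ m₁ m₂ ↑) (x ∷ A)) ≡ (x ∨ not (A ⊆ᵇ m₁ ∨ A ⊆ᵇ m₂)) ∷ A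
closure-K₁₂ m₁ m₂ x A = begin
    (K₁₂ m₁ m₂ ↓) ((K₁₂ m₁ m₂ ↑) (x ∷ A))
  ≡⟨ cong (K₁₂ m₁ m₂ ↓) (↑-K₁₂ m₁ m₂ x A) ⟩
    (K₁₂ m₁ m₂ ↓) (b₁ ∷ b₂ ∷ ∁ A)
  ≡⟨ ↓-K₁₂ m₁ m₂ b₁ b₂ A ⟩
    (not b₁ ∧ not b₂) ∷ tabulate (λ i → (not b₁ ∨ lookup m₁ i) ∧ ((not b₂ ∨ lookup m₂ i) ∧ lookup A i))
  ≡⟨ cong₂ _∷_ (g₁-added x (A ⊆ᵇ m₁) (A ⊆ᵇ m₂)) (tabulate-≡ _ A kept) ⟩
    (x ∨ not (A ⊆ᵇ m₁ ∨ A ⊆ᵇ m₂)) ∷ A ∎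
  where
  b₁ b₂ : Bool
  b₁ = not x ∧ A ⊆ᵇ m₁
  b₂ = not x ∧ A ⊆ᵇ m₂
  g₁-added : ∀ x s₁ s₂ → (not (not x ∧ s₁) ∧ not (not x ∧ s₂)) ≡ (x ∨ not (s₁ ∨ s₂))
  g₁-added true  s₁    s₂    = refl
  g₁-added false true  s₂    = refl
  g₁-added false false s₂    = refl
  ⊆-if : ∀ y (m : Subset _) (i : Fin _) → (y ∧ A ⊆ᵇ m) ≡ true → lookup A i ≡ true → lookup m i ≡ true
  ⊆-if true  m i = ⊆ᵇ-sound A m i
  ⊆-if false m i ()
  kept : ∀ i → ((not b₁ ∨ lookup m₁ i) ∧ ((not b₂ ∨ lookup m₂ i) ∧ lookup A i)) ≡ lookup A i
  kept i = trans (cong ((not b₁ ∨ lookup m₁ i) ∧_) (⇒-absorb b₂ _ _ (⊆-if (not x) m₂ i)))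
                 (⇒-absorb b₁ _ _ (⊆-if (not x) m₁ i))

isExtent-K₁₂ : ∀ {n} (m₁ m₂ : Subset n) (x : Bool) (A : Subset n) →
  isExtent (K₁₂ m₁ m₂) (x ∷ A) ≡ x ∨ (A ⊆ᵇ m₁ ∨ A ⊆ᵇ m₂)
isExtent-K₁₂ m₁ m₂ x A = begin
    ⌊ (K₁₂ m₁ m₂ ↓) ((K₁₂ m₁ m₂ ↑) (x ∷ A)) ≟ₛ (x ∷ A) ⌋
  ≡⟨ cong (λ X → ⌊ X ≟ₛ (x ∷ A) ⌋) (closure-K₁₂ m₁ m₂ x A) ⟩
    ⌊ ((x ∨ not s) ∷ A) ≟ₛ (x ∷ A) ⌋
  ≡⟨ ≟ₛ-same-tail (x ∨ not s) x A ⟩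
    ⌊ (x ∨ not s) ≟ᵇ x ⌋
  ≡⟨ unchanged-iff x s ⟩
    x ∨ s ∎
  where
  s : Bool
  s = A ⊆ᵇ m₁ ∨ A ⊆ᵇ m₂
  unchanged-iff : ∀ x s → ⌊ (x ∨ not s) ≟ᵇ x ⌋ ≡ x ∨ s
  unchanged-iff true  s     = refl
  unchanged-iff false true  = refl
  unchanged-iff false false = refl

count-K₁₂ : ∀ {n} (m₁ m₂ : Subset n) →
  count (isExtent (K₁₂ m₁ m₂)) ≡ count (λ A → A ⊆ᵇ m₁ ∨ A ⊆ᵇ m₂) + 2 ^ n
count-K₁₂ {n} m₁ m₂ =
  cong₂ _+_ (count-cong _ _ (isExtent-K₁₂ m₁ m₂ false))
            (trans (count-cong _ _ (isExtent-K₁₂ m₁ m₂ true)) (count-true {n}))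

Covers : ∀ {k} → Subset k → Subset k → Set
Covers m₁ m₂ = ∀ i → (lookup m₁ i ∨ lookup m₂ i) ≡ true

∪≡⊤⇒Covers : ∀ {k} (m₁ m₂ : Subset k) → m₁ ∪ m₂ ≡ ⊤ → Covers m₁ m₂
∪≡⊤⇒Covers m₁ m₂ m₁∪m₂≡⊤ i = begin
    lookup m₁ i ∨ lookup m₂ i   ≡⟨ sym (lookup-zipWith _∨_ i m₁ m₂) ⟩
    lookup (m₁ ∪ m₂) i          ≡⟨ cong (λ v → lookup v i) m₁∪m₂≡⊤ ⟩
    lookup ⊤ i                  ≡⟨ lookup-replicate i true ⟩
    true ∎

↑-Kₛ : ∀ {n} (m₁ m₂ : Subset n) → Covers m₁ m₂ →
  (x : Bool) (A : Subset n) → (Kₛ m₁ m₂ ↑) (x ∷ A) ≡ not x ∷ ∁ A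
↑-Kₛ m₁ m₂ covers x A =
  cong₂ _∷_ (head-entry (not x) _ (allFin-true _ (λ i →
              trans (cong (not (lookup A i) ∨_) (covers i)) (∨-zeroʳ (not (lookup A i))))))
    (tabulate-≡ _ (∁ A) (contranominal-↑′ x A))

↓-Kₛ : ∀ {n} (m₁ m₂ : Subset n) → Covers m₁ m₂ →
  (b : Bool) (A : Subset n) → (Kₛ m₁ m₂ ↓) (b ∷ ∁ A) ≡ not b ∷ A
↓-Kₛ m₁ m₂ covers b A =
  cong₂ _∷_ (head-entry (not b) _ (all-∨-true (∁ A)))
    (tabulate-≡ _ A (λ i →
      cong₂ _∧_ (trans (cong (not b ∨_) (covers i)) (∨-zeroʳ (not b))) (contranominal-↓ A i)))

isExtent-Kₛ : ∀ {n} (m₁ m₂ : Subset n) → Covers m₁ m₂ →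
  (X : Subset (suc n)) → isExtent (Kₛ m₁ m₂) X ≡ true
isExtent-Kₛ m₁ m₂ covers (x ∷ A) = ⌊⌋-true (_ ≟ₛ (x ∷ A)) (begin
    (Kₛ m₁ m₂ ↓) ((Kₛ m₁ m₂ ↑) (x ∷ A))  ≡⟨ cong (Kₛ m₁ m₂ ↓) (↑-Kₛ m₁ m₂ covers x A) ⟩
    (Kₛ m₁ m₂ ↓) (not x ∷ ∁ A)           ≡⟨ ↓-Kₛ m₁ m₂ covers (not x) A ⟩
    not (not x) ∷ A                       ≡⟨ cong (_∷ A) (not-involutive x) ⟩
    x ∷ A ∎)

count-Kₛ : ∀ {n} (m₁ m₂ : Subset n) → Covers m₁ m₂ →
  count (isExtent (Kₛ m₁ m₂)) ≡ 2 ^ n + 2 ^ n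
count-Kₛ {n} m₁ m₂ covers =
  cong₂ _+_ (all-extents (λ A → false ∷ A)) (all-extents (λ A → true ∷ A))
  where
  all-extents : (ι : Subset n → Subset (suc n)) → count (λ A → isExtent (Kₛ m₁ m₂) (ι A)) ≡ 2 ^ n
  all-extents ι = trans (count-cong _ _ (λ A → isExtent-Kₛ m₁ m₂ covers (ι A))) (count-true {n})

-- Arithmetic of the two counts.  With a₁ + a₂ = c + e (inclusion–exclusion),
-- the paper's expression P + a₂ + a₁ − e for |𝔅(𝕂₁₂)| equals c + P ...
paper-count : ∀ P a₁ a₂ c e → a₁ + a₂ ≡ c + e → P + a₂ + a₁ ∸ e ≡ c + P
paper-count P a₁ a₂ c e excl = begin
    P + a₂ + a₁ ∸ e      ≡⟨ cong (_∸ e) regrouped ⟩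
    c + P + e ∸ e        ≡⟨ m+n∸n≡m (c + P) e ⟩
    c + P ∎
  where
  regroup₁ : ∀ P a₁ a₂ → P + a₂ + a₁ ≡ P + (a₁ + a₂)
  regroup₁ = ℕ-Solver.solve-∀
  regroup₂ : ∀ P c e → P + (c + e) ≡ c + P + e
  regroup₂ = ℕ-Solver.solve-∀
  regrouped : P + a₂ + a₁ ≡ c + P + e
  regrouped = begin
    P + a₂ + a₁    ≡⟨ regroup₁ P a₁ a₂ ⟩
    P + (a₁ + a₂)  ≡⟨ cong (_+_ P) excl ⟩
    P + (c + e)    ≡⟨ regroup₂ P c e ⟩
    c + P + e ∎

paper-difference : ∀ P a₁ a₂ c e → a₁ + a₂ ≡ c + e →
  + (P + P) ℤ.- + (c + P) ≡ + P ℤ.- + a₁ ℤ.- + a₂ ℤ.+ + e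
paper-difference P a₁ a₂ c e excl = begin
    + (P + P) ℤ.- + (c + P)            ≡⟨ cong₂ ℤ._-_ (pos-+ P P) (pos-+ c P) ⟩
    (+ P ℤ.+ + P) ℤ.- (+ c ℤ.+ + P)    ≡⟨ regroup₁ (+ P) (+ c) (+ e) ⟩
    + P ℤ.- (+ c ℤ.+ + e) ℤ.+ + e      ≡⟨ cong (λ z → + P ℤ.- z ℤ.+ + e) exclℤ ⟩
    + P ℤ.- (+ a₁ ℤ.+ + a₂) ℤ.+ + e    ≡⟨ regroup₂ (+ P) (+ a₁) (+ a₂) (+ e) ⟩
    + P ℤ.- + a₁ ℤ.- + a₂ ℤ.+ + e ∎
  where
  exclℤ : + c ℤ.+ + e ≡ + a₁ ℤ.+ + a₂
  exclℤ = trans (sym (pos-+ c e)) (trans (cong +_ (sym excl)) (pos-+ a₁ a₂))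
  regroup₁ : ∀ p c e → (p ℤ.+ p) ℤ.- (c ℤ.+ p) ≡ p ℤ.- (c ℤ.+ e) ℤ.+ e
  regroup₁ = ℤ-Solver.solve-∀
  regroup₂ : ∀ p a₁ a₂ e → p ℤ.- (a₁ ℤ.+ a₂) ℤ.+ e ≡ p ℤ.- a₁ ℤ.- a₂ ℤ.+ e
  regroup₂ = ℤ-Solver.solve-∀

-- Proposition 6.
proposition6 : (n : ℕ) → 2 < n → (m₁' m₂' : Subset n) →
  m₁' ∪ m₂' ≡ ⊤ →
  ⊥ ⊂ m₁' → m₁' ⊂ ⊤ → ⊥ ⊂ m₂' → m₂' ⊂ ⊤ →
  Nonempty (m₁' ∩ m₂') →
  ¬ (m₁' ⊆ m₂') → ¬ (m₂' ⊆ m₁') →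
  (Fin (2 ^ n + 2 ^ ∣ m₂' ∣ + 2 ^ ∣ m₁' ∣ ∸ 2 ^ ∣ m₁' ∩ m₂' ∣) ↔ Concept (K₁₂ m₁' m₂'))
  × Σ ℕ (λ k → (Fin k ↔ Concept (Kₛ m₁' m₂'))
      × ((+ k) ℤ.- (+ (2 ^ n + 2 ^ ∣ m₂' ∣ + 2 ^ ∣ m₁' ∣ ∸ 2 ^ ∣ m₁' ∩ m₂' ∣))
          ≡ (+ (2 ^ n)) ℤ.- (+ (2 ^ ∣ m₁' ∣)) ℤ.- (+ (2 ^ ∣ m₂' ∣)) ℤ.+ (+ (2 ^ ∣ m₁' ∩ m₂' ∣))))
proposition6 n _ m₁' m₂' m₁'∪m₂'≡⊤ _ _ _ _ _ _ _ =
  subst (λ k → Fin k ↔ Concept (K₁₂ m₁' m₂')) |𝔅₁₂| (concepts-count (K₁₂ m₁' m₂')) ,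
  count (isExtent (Kₛ m₁' m₂')) , concepts-count (Kₛ m₁' m₂') ,
  (begin
    + count (isExtent (Kₛ m₁' m₂')) ℤ.- + (2 ^ n + 2 ^ ∣ m₂' ∣ + 2 ^ ∣ m₁' ∣ ∸ 2 ^ ∣ m₁' ∩ m₂' ∣)
  ≡⟨ cong₂ (λ a b → + a ℤ.- + b) (count-Kₛ m₁' m₂' covers) paper-form ⟩
    + (2 ^ n + 2 ^ n) ℤ.- + (c + 2 ^ n)
  ≡⟨ paper-difference (2 ^ n) (2 ^ ∣ m₁' ∣) (2 ^ ∣ m₂' ∣) c (2 ^ ∣ m₁' ∩ m₂' ∣) excl ⟩
    + (2 ^ n) ℤ.- + (2 ^ ∣ m₁' ∣) ℤ.- + (2 ^ ∣ m₂' ∣) ℤ.+ + (2 ^ ∣ m₁' ∩ m₂' ∣) ∎)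
  where
  covers : Covers m₁' m₂'
  covers = ∪≡⊤⇒Covers m₁' m₂' m₁'∪m₂'≡⊤
  c : ℕ
  c = count (λ A → A ⊆ᵇ m₁' ∨ A ⊆ᵇ m₂')
  excl : 2 ^ ∣ m₁' ∣ + 2 ^ ∣ m₂' ∣ ≡ c + 2 ^ ∣ m₁' ∩ m₂' ∣
  excl = count-⊆-either m₁' m₂'
  paper-form : 2 ^ n + 2 ^ ∣ m₂' ∣ + 2 ^ ∣ m₁' ∣ ∸ 2 ^ ∣ m₁' ∩ m₂' ∣ ≡ c + 2 ^ n
  paper-form = paper-count (2 ^ n) _ _ c _ excl
  |𝔅₁₂| : count (isExtent (K₁₂ m₁' m₂')) ≡ 2 ^ n + 2 ^ ∣ m₂' ∣ + 2 ^ ∣ m₁' ∣ ∸ 2 ^ ∣ m₁' ∩ m₂' ∣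
  |𝔅₁₂| = trans (count-K₁₂ m₁' m₂') (sym paper-form)
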